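{- Let $T$ be a tournament with no transmitter and no receiver which is not strongly connected, with initial strong component $T_1$ and terminal strong component $T_m$. Then $T$ is quadrangular if and only if $T_{1}$ is in-quadrangular with $\delta^{ - }(T_{1})\geq 2$ and $T_{m}$ is out-quadrangular with $\delta^{+}(T_{m})\geq 2$.
   Context: A tournament $T$ is a loopless digraph in which for each pair of distinct vertices exactly one of $(u,v)$, $(v,u)$ is an arc; $u\rightarrow v$ means $(u,v)$ is an arc. $O(v)=\{u:v\rightarrow u\}$, $I(v)=\{u:u\rightarrow v\}$. A digraph is quadrangular if for all distinct $u,v$, $|O(u)\cap O(v)|\neq 1$ and $|I(u)\cap I(v)|\neq 1$; out-quadrangular if only the first condition is required, in-quadrangular if only the second. A transmitter dominates all other vertices; a receiver is dominated by all other vertices. If $T$ is not strongly connected, its strong components (induced subtournaments) can be labeled $T_1,\dots,T_m$ so that every vertex of $T_i$ beats every vertex of $T_j$ whenever $i<j$; $T_1$ is the initial and $T_m$ the terminal strong component. $\delta^{+}$ and $\delta^{ - }$ denote minimum out-degree and minimum in-degree (computed within the subtournament). -}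

module Defs where

open import Data.Nat using (ℕ; zero; suc; _+_; _≤_)
open import Data.Fin using (Fin; zero; suc)
open import Data.Bool using (Bool; true; false; not; if_then_else_; _∧_)
open import Data.Product using (_×_; ∃)
open import Relation.Binary.PropositionalEquality using (_≡_; _≢_)
open import Relation.Nullary using (¬_)

-- A tournament on the vertex set Fin n; arc u v ≡ true means u → v.
record Tournament (n : ℕ) : Set where
  field
    arc      : Fin n → Fin n → Bool
    loopless : ∀ v → arc v v ≡ false
    complete : ∀ u v → u ≢ v → arc u v ≡ not (arc v u)
open Tournament public

count : ∀ {n} → (Fin n → Bool) → ℕ
count {zero}  f = 0
count {suc n} f = (if f zero then 1 else 0) + count (λ i → f (suc i))

VSet : ℕ → Set
VSet n = Fin n → Bool

full : ∀ {n} → VSet n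
full _ = true

module _ {n : ℕ} (T : Tournament n) where

  commonOut : VSet n → Fin n → Fin n → ℕ
  commonOut S u v = count (λ w → S w ∧ (arc T u w ∧ arc T v w))

  commonIn : VSet n → Fin n → Fin n → ℕ
  commonIn S u v = count (λ w → S w ∧ (arc T w u ∧ arc T w v))

  outDeg : VSet n → Fin n → ℕ
  outDeg S v = count (λ w → S w ∧ arc T v w)

  inDeg : VSet n → Fin n → ℕ
  inDeg S v = count (λ w → S w ∧ arc T w v)

  OutQuadOn : VSet n → Set
  OutQuadOn S = ∀ u v → S u ≡ true → S v ≡ true → u ≢ v → commonOut S u v ≢ 1

  InQuadOn : VSet n → Set
  InQuadOn S = ∀ u v → S u ≡ true → S v ≡ true → u ≢ v → commonIn S u v ≢ 1

  Quadrangular : Set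
  Quadrangular = OutQuadOn full × InQuadOn full

  MinOutDegOn≥ : VSet n → ℕ → Set
  MinOutDegOn≥ S k = ∀ v → S v ≡ true → k ≤ outDeg S v

  MinInDegOn≥ : VSet n → ℕ → Set
  MinInDegOn≥ S k = ∀ v → S v ≡ true → k ≤ inDeg S v

  IsTransmitter : Fin n → Set
  IsTransmitter v = ∀ u → u ≢ v → arc T v u ≡ true

  IsReceiver : Fin n → Set
  IsReceiver v = ∀ u → u ≢ v → arc T u v ≡ true

  data Reach : Fin n → Fin n → Set where
    here : ∀ {u} → Reach u u
    step : ∀ {u w v} → arc T u w ≡ true → Reach w v → Reach u v

  StronglyConnected : Set
  StronglyConnected = ∀ u v → Reach u v

  IsStrongComponent : VSet n → Set
  IsStrongComponent S =
    ∃ (λ u → S u ≡ true) ×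
    (∀ u v → S u ≡ true → (S v ≡ true → Reach u v × Reach v u)
                         × (Reach u v → Reach v u → S v ≡ true))

  IsInitialComponent : VSet n → Set
  IsInitialComponent S = IsStrongComponent S ×
    (∀ u v → S u ≡ true → S v ≡ false → arc T u v ≡ true)

  IsTerminalComponent : VSet n → Set
  IsTerminalComponent S = IsStrongComponent S ×
    (∀ u v → S u ≡ true → S v ≡ false → arc T v u ≡ true)

{-# OPTIONS --safe #-}
module Submission where

-- Let S be a set of vertices beaten by every vertex outside it (e.g. the terminal strong
-- component), and let u, v be distinct.  Out-neighbourhoods of vertices of S stay inside S,
-- so: for u, v ∈ S the common out-neighbourhood is the same in T and in T[S]; for u ∈ S,
-- v ∉ S it is all of O(u); for u, v ∉ S it contains S.  Hence T is out-quadrangular iff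
-- T[S] is out-quadrangular and no vertex of S has out-degree 1 in T[S] (out-degree 0 would
-- make it a receiver).  The in-side is the same statement for the reversed tournament and
-- the initial component.

open import Defs
open import Data.Nat using (ℕ; zero; suc; _+_; _≤_; _<_; z≤n; s≤s)
open import Data.Nat.Properties using (≤-trans; m≤n+m; >⇒≢; ≤∧≢⇒<; n≢0⇒n>0; module ≤-Reasoning)
open import Data.Fin using (Fin; zero; suc)
open import Data.Fin.Properties using (any?)
open import Data.Bool using (Bool; true; false; not; if_then_else_; _∧_)
open import Data.Bool.Properties using (∧-comm; ∧-conicalˡ) renaming (_≟_ to _≟ᵇ_)
open import Data.Product using (_×_; ∃; _,_; proj₁; swap)
open import Data.Product.Function.NonDependent.Propositional using (_×-⇔_)
open import Function using (_∘_)
open import Function.Bundles using (_⇔_; mk⇔)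
open import Function.Properties.Equivalence using () renaming (trans to ⇔-trans)
open import Relation.Nullary using (¬_; yes; no; contradiction)
open import Relation.Binary.PropositionalEquality using (_≡_; _≢_; refl; sym; trans; cong; cong₂)

private
  variable
    n : ℕ

_⊆_ : (Fin n → Bool) → (Fin n → Bool) → Set
f ⊆ g = ∀ w → f w ≡ true → g w ≡ true

count-cong : {f g : Fin n → Bool} → (∀ w → f w ≡ g w) → count f ≡ count g
count-cong {zero}  _   = refl
count-cong {suc n} f≗g =
  cong₂ _+_ (cong (λ b → if b then 1 else 0) (f≗g zero)) (count-cong (f≗g ∘ suc))

count-mono : {f g : Fin n → Bool} → f ⊆ g → count f ≤ count g
count-mono {zero}          _   = z≤n
count-mono {suc n} {f} {g} f⊆g with f zero in f0
... | true rewrite f⊆g zero f0 = s≤s (count-mono (f⊆g ∘ suc))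
... | false = ≤-trans (count-mono (f⊆g ∘ suc)) (m≤n+m _ (if g zero then 1 else 0))

count-pos : {f : Fin n → Bool} (w : Fin n) → f w ≡ true → 0 < count f
count-pos         zero    fw rewrite fw = s≤s z≤n
count-pos {f = f} (suc w) fw = ≤-trans (count-pos w fw) (m≤n+m _ (if f zero then 1 else 0))

count-∧ʳ : {f g : Fin n → Bool} → f ⊆ g → count (λ w → f w ∧ g w) ≡ count f
count-∧ʳ {f = f} {g} f⊆g = count-cong pointwise
  where
  pointwise : ∀ w → (f w ∧ g w) ≡ f w
  pointwise w with f w in fw
  ... | true  = f⊆g w fw
  ... | false = refl

count-∧ˡ : {f g : Fin n → Bool} → f ⊆ g → count (λ w → g w ∧ f w) ≡ count f
count-∧ˡ {f = f} {g} f⊆g = trans (count-cong (λ w → ∧-comm (g w) (f w))) (count-∧ʳ f⊆g)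

∈∉⇒≢ : {S : VSet n} {u v : Fin n} → S u ≡ true → S v ≡ false → u ≢ v
∈∉⇒≢ u∈S v∉S refl = contradiction (trans (sym u∈S) v∉S) λ ()

module _ (T : Tournament n) where

  arc-asym : ∀ {u v} → arc T u v ≡ true → arc T v u ≡ false
  arc-asym {u} {v} u→v = trans (complete T v u v≢u) (cong not u→v)
    where
    v≢u : v ≢ u
    v≢u refl = contradiction (trans (sym u→v) (loopless T v)) λ ()

  arc-flip : ∀ {u v} → u ≢ v → arc T u v ≡ false → arc T v u ≡ true
  arc-flip u≢v u↛v = trans (complete T _ _ (u≢v ∘ sym)) (cong not u↛v)

  outDegree≡0⇒receiver : ∀ {v} → count (arc T v) ≡ 0 → IsReceiver T v
  outDegree≡0⇒receiver {v} d≡0 u u≢v with arc T v u in v→u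
  ... | true  = contradiction d≡0 (>⇒≢ (count-pos u v→u))
  ... | false = arc-flip (u≢v ∘ sym) v→u

  commonOut-comm : ∀ S u v → commonOut T S u v ≡ commonOut T S v u
  commonOut-comm S u v = count-cong (λ w → cong (S w ∧_) (∧-comm (arc T u w) (arc T v w)))

  strongComponent-proper : ¬ StronglyConnected T → ∀ {S} → IsStrongComponent T S →
                           ∃ λ x → S x ≡ false
  strongComponent-proper notStrong {S} (_ , component) with any? (λ w → S w ≟ᵇ false)
  ... | yes outside   = outside
  ... | no  noOutside = contradiction (λ u v → proj₁ (proj₁ (component u v (inS u)) (inS v))) notStrong
    where
    inS : ∀ w → S w ≡ true
    inS w with S w in Sw
    ... | true  = refl
    ... | false = contradiction (w , Sw) noOutside

reverse : Tournament n → Tournament n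
reverse T = record
  { arc      = λ u v → arc T v u
  ; loopless = loopless T
  ; complete = λ u v u≢v → complete T v u (u≢v ∘ sym)
  }

module TerminalSet (T : Tournament n) (S : VSet n)
  (beaten : ∀ u v → S u ≡ true → S v ≡ false → arc T v u ≡ true) where

  out-closed : ∀ {u} → S u ≡ true → arc T u ⊆ S
  out-closed {u} u∈S w u→w with S w in Sw
  ... | true  = refl
  ... | false = contradiction (beaten u w u∈S Sw) λ w→u →
                  contradiction (trans (sym w→u) (arc-asym T u→w)) λ ()

  outDeg-inside : ∀ {u} → S u ≡ true → outDeg T S u ≡ count (arc T u)
  outDeg-inside u∈S = count-∧ˡ (out-closed u∈S)

  commonOut-inside : ∀ {u} v → S u ≡ true → commonOut T S u v ≡ commonOut T full u v
  commonOut-inside {u} v u∈S =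
    count-∧ˡ (λ w uv→w → out-closed u∈S w (∧-conicalˡ (arc T u w) (arc T v w) uv→w))

  commonOut-across : ∀ {u v} → S u ≡ true → S v ≡ false → commonOut T full u v ≡ outDeg T S u
  commonOut-across {u} {v} u∈S v∉S =
    trans (count-∧ʳ (λ w u→w → beaten w v (out-closed u∈S w u→w) v∉S)) (sym (outDeg-inside u∈S))

  size≤commonOut-outside : ∀ {u v} → S u ≡ false → S v ≡ false → count S ≤ commonOut T full u v
  size≤commonOut-outside u∉S v∉S =
    count-mono (λ w w∈S → cong₂ _∧_ (beaten w _ w∈S u∉S) (beaten w _ w∈S v∉S))

  outQuadOn-restrict : OutQuadOn T full → OutQuadOn T S
  outQuadOn-restrict quad u v u∈S _ u≢v = quad u v refl refl u≢v ∘ trans (sym (commonOut-inside v u∈S))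

  minOutDeg≥2 : ¬ ∃ (IsReceiver T) → ∀ {x} → S x ≡ false → OutQuadOn T full → MinOutDegOn≥ T S 2
  minOutDeg≥2 noReceiver {x} x∉S quad v v∈S = ≤∧≢⇒< (n≢0⇒n>0 outDeg≢0) (outDeg≢1 ∘ sym)
    where
    outDeg≢0 : outDeg T S v ≢ 0
    outDeg≢0 = noReceiver ∘ (v ,_) ∘ outDegree≡0⇒receiver T ∘ trans (sym (outDeg-inside v∈S))
    outDeg≢1 : outDeg T S v ≢ 1
    outDeg≢1 = quad v x refl refl (∈∉⇒≢ v∈S x∉S) ∘ trans (commonOut-across v∈S x∉S)

  outQuadOn-full : ∀ {y} → S y ≡ true → OutQuadOn T S → MinOutDegOn≥ T S 2 → OutQuadOn T full
  outQuadOn-full {y} y∈S quad δ≥2 u v _ _ u≢v with S u in Su | S v in Sv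
  ... | true  | true  = quad u v Su Sv u≢v ∘ trans (commonOut-inside v Su)
  ... | true  | false = >⇒≢ (begin 2 ≤⟨ δ≥2 u Su ⟩ outDeg T S u ≡⟨ commonOut-across Su Sv ⟨
                                   commonOut T full u v ∎)
    where open ≤-Reasoning
  ... | false | true  = >⇒≢ (begin 2 ≤⟨ δ≥2 v Sv ⟩ outDeg T S v ≡⟨ commonOut-across Sv Su ⟨
                                   commonOut T full v u ≡⟨ commonOut-comm T full v u ⟩
                                   commonOut T full u v ∎)
    where open ≤-Reasoning
  ... | false | false = >⇒≢ (begin 2 ≤⟨ δ≥2 y y∈S ⟩ outDeg T S y ≤⟨ count-mono (λ w → ∧-conicalˡ (S w) _) ⟩
                                   count S ≤⟨ size≤commonOut-outside Su Sv ⟩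
                                   commonOut T full u v ∎)
    where open ≤-Reasoning

  outQuadrangular⇔ : ¬ ∃ (IsReceiver T) → ∃ (λ x → S x ≡ false) → ∃ (λ y → S y ≡ true) →
                     OutQuadOn T full ⇔ (OutQuadOn T S × MinOutDegOn≥ T S 2)
  outQuadrangular⇔ noReceiver (x , x∉S) (y , y∈S) = mk⇔
    (λ quad → outQuadOn-restrict quad , minOutDeg≥2 noReceiver x∉S quad)
    (λ (quad , δ≥2) → outQuadOn-full y∈S quad δ≥2)

theorem4 : ∀ {n : ℕ} (T : Tournament n) →
    ¬ ∃ (IsTransmitter T) → ¬ ∃ (IsReceiver T) → ¬ StronglyConnected T →
    ∀ (T₁ Tₘ : VSet n) → IsInitialComponent T T₁ → IsTerminalComponent T Tₘ →
    Quadrangular T ⇔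
      ((InQuadOn T T₁ × MinInDegOn≥ T T₁ 2) × (OutQuadOn T Tₘ × MinOutDegOn≥ T Tₘ 2))
theorem4 T noTransmitter noReceiver notStrong T₁ Tₘ (T₁-strong , T₁-beats) (Tₘ-strong , Tₘ-beaten) =
  ⇔-trans (terminalSide ×-⇔ initialSide) (mk⇔ swap swap)
  where
  terminalSide : OutQuadOn T full ⇔ (OutQuadOn T Tₘ × MinOutDegOn≥ T Tₘ 2)
  terminalSide = TerminalSet.outQuadrangular⇔ T Tₘ Tₘ-beaten noReceiver
                   (strongComponent-proper T notStrong Tₘ-strong) (proj₁ Tₘ-strong)
  initialSide : InQuadOn T full ⇔ (InQuadOn T T₁ × MinInDegOn≥ T T₁ 2)
  initialSide = TerminalSet.outQuadrangular⇔ (reverse T) T₁ T₁-beats noTransmitter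
                  (strongComponent-proper T notStrong T₁-strong) (proj₁ T₁-strong)
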